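{- For $n\ge 2$, the collapsibility number of the Čech complex $\mathcal{N}(\mathbb{I}_n,2)$ is $3$.
   Context: For a finite simple connected graph $G$ and a real number $r\ge 0$, the Čech complex $\mathcal{N}(G,r)$ is the simplicial complex with vertex set $V(G)$ in which a finite nonempty set $\sigma\subseteq V(G)$ is a simplex if and only if the closed balls of radius $\frac r2$ centered at the vertices of $\sigma$ have a common point, the balls being taken in the geometric realization of $G$ with the shortest path metric in which each edge is isometric to $[0,1]$. The hypercube graph $\mathbb{I}_n$ has vertex set $\{0,1\}^n$, two vertices adjacent iff they differ in exactly one coordinate. Let $X$ be a finite simplicial complex. If $\sigma\in X$ satisfies $|\sigma|\le d$ and there is a unique maximal simplex $\gamma\in X$ containing $\sigma$, then removing from $X$ all simplices $\delta$ with $\sigma\subseteq\delta\subseteq\gamma$ yields a subcomplex $Y$, called an elementary $d$-collapse of $X$ (here $\gamma=\sigma$ is allowed). $X$ is $d$-collapsible if there is a finite sequence of elementary $d$-collapses from $X$ to the void (empty) complex. The collapsibility number of $X$ is the minimal integer $d$ such that $X$ is $d$-collapsible.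
   Formalization: Points of the geometric realization of 𝕀_n used in the Čech complex have their position along an edge taken in the rationals rather than the reals. -}

module Defs where

open import Level using (0ℓ)
open import Data.Nat as ℕ using (ℕ; zero; suc)
open import Data.Bool using (Bool; true; false; if_then_else_)
open import Data.Vec using (Vec; []; _∷_; lookup)
open import Data.Fin using (Fin)
open import Data.List using (List; []; _∷_; map; _++_)
open import Data.Nat.ListAction using (sum)
open import Data.Integer using (+_)
open import Data.Rational using (ℚ; _/_; _+_; _-_; _*_; _≤_; 0ℚ; 1ℚ; ½)
open import Data.Product using (Σ; ∃; _×_; _,_)
open import Data.Sum using (_⊎_)
open import Relation.Nullary using (¬_)
open import Relation.Binary.PropositionalEquality using (_≡_; _≢_)

V : ℕ → Set
V n = Vec Bool n

Adj : ∀ {n} → V n → V n → Set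
Adj {n} u v = Σ (Fin n) λ i → (lookup u i ≢ lookup v i) ×
                 (∀ (j : Fin n) → j ≢ i → lookup u j ≡ lookup v j)

data Walk {n : ℕ} : V n → V n → ℕ → Set where
  nil  : ∀ {v} → Walk v v 0
  cons : ∀ {u w v k} → Adj u w → Walk w v k → Walk u v (suc k)

ℕ→ℚ : ℕ → ℚ
ℕ→ℚ k = (+ k) / 1

-- a point is either a vertex, or the point at parameter t ∈ [0,1]
-- on the edge from a to b (at distance t from a and 1 - t from b)
data Point (n : ℕ) : Set where
  vtx  : V n → Point n
  onEdge : (a b : V n) → Adj a b → (t : ℚ) → 0ℚ ≤ t → t ≤ 1ℚ → Point n

-- d(v , p) ≤ ρ for the shortest path metric of the geometric realization
-- (d(v,a) = graph distance = least length of a walk)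
InBall : ∀ {n} → V n → ℚ → Point n → Set
InBall v ρ (vtx w) = ∃ λ k → Walk v w k × (ℕ→ℚ k ≤ ρ)
InBall v ρ (onEdge a b _ t _ _) =
  (∃ λ k → Walk v a k × (ℕ→ℚ k + t ≤ ρ)) ⊎
  (∃ λ k → Walk v b k × (ℕ→ℚ k + (1ℚ - t) ≤ ρ))

VSet : ℕ → Set
VSet n = V n → Bool

_∈ₛ_ : ∀ {n} → V n → VSet n → Set
v ∈ₛ σ = σ v ≡ true

_⊆ₛ_ : ∀ {n} → VSet n → VSet n → Set
σ ⊆ₛ τ = ∀ v → v ∈ₛ σ → v ∈ₛ τ

NonEmpty : ∀ {n} → VSet n → Set
NonEmpty σ = ∃ λ v → v ∈ₛ σ

allV : (n : ℕ) → List (V n)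
allV zero    = [] ∷ []
allV (suc n) = map (true ∷_) (allV n) ++ map (false ∷_) (allV n)

card : ∀ {n} → VSet n → ℕ
card {n} σ = sum (map (λ v → if σ v then 1 else 0) (allV n))

Complex : ℕ → Set₁
Complex n = VSet n → Set

Cech : (n : ℕ) → ℚ → Complex n
Cech n r σ = NonEmpty σ × (∃ λ (p : Point n) → ∀ v → v ∈ₛ σ → InBall v (r * ½) p)

Maximal : ∀ {n} → Complex n → VSet n → Set
Maximal X γ = X γ × (∀ τ → X τ → γ ⊆ₛ τ → τ ⊆ₛ γ)

record ElemCollapse {n : ℕ} (d : ℕ) (X Y : Complex n) : Set where
  field
    σ γ      : VSet n
    σ∈X      : X σ
    card≤d   : card σ ℕ.≤ d
    σ⊆γ      : σ ⊆ₛ γ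
    γ-max    : Maximal X γ
    unique   : ∀ τ → Maximal X τ → σ ⊆ₛ τ → (τ ⊆ₛ γ × γ ⊆ₛ τ)
    Y-def₁   : ∀ δ → Y δ → X δ × ¬ (σ ⊆ₛ δ × δ ⊆ₛ γ)
    Y-def₂   : ∀ δ → X δ → ¬ (σ ⊆ₛ δ × δ ⊆ₛ γ) → Y δ

Void : ∀ {n} → Complex n → Set
Void X = ∀ τ → ¬ X τ

data Collapsible {n : ℕ} (d : ℕ) : Complex n → Set₁ where
  done : ∀ {X} → Void X → Collapsible d X
  step : ∀ {X} (Y : Complex n) → ElemCollapse d X Y → Collapsible d Y → Collapsible d X

CollapsibilityNumber : ∀ {n} → Complex n → ℕ → Set₁
CollapsibilityNumber X c = Collapsible c X × (∀ d → d ℕ.< c → ¬ Collapsible d X)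

-- The faces of N(I_n, 2) are the nonempty vertex sets inside a closed neighbourhood N[c]
-- (the balls have radius 1), and three distinct vertices of N[c] determine c.
--
-- Upper bound: for every vertex c, the faces with at least three vertices in N[c] are
-- collapsed through the intervals [σ, σ ∪ {vertices of N[c] after σ}], σ running over the
-- 3-subsets of N[c] in lexicographic order; what remains is a graph, whose edges and then
-- vertices are collapsed one at a time.
--
-- Lower bound: for n ≥ 2 let S be a square in the first two coordinates. Each S minus one
-- corner is a face (around the opposite corner), and no elementary 2-collapse removes it:
-- the top γ misses a corner y of S, the free face σ has at most two vertices so misses
-- another corner x, and a maximal coface of S ∖ {x} ⊇ σ must be γ, yet it contains y.

module Submission where

open import Defs
open import Data.Bool using (Bool; true; false; _∨_; _∧_; not; if_then_else_)
import Data.Bool as Bool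
open import Data.Bool.Properties using (not-¬; not-involutive)
open import Data.Empty using (⊥; ⊥-elim)
open import Data.Unit using (⊤; tt)
open import Data.Fin using (Fin; zero; suc)
import Data.Fin.Properties as Fin
open import Data.Integer using (+_)
import Data.Integer as ℤ
open import Data.List using (List; []; _∷_; map; length; allFin)
open import Data.List.Membership.Propositional using (_∈_)
open import Data.List.Membership.Propositional.Properties
  using (∈-map⁺; ∈-map⁻; ∈-++⁺ˡ; ∈-++⁺ʳ; ∈-allFin)
open import Data.List.Relation.Unary.All as All using (All; []; _∷_)
open import Data.List.Relation.Unary.AllPairs using ([]; _∷_)
open import Data.List.Relation.Unary.Any using (here; there)
open import Data.List.Relation.Unary.Unique.Propositional using (Unique)
import Data.List.Relation.Unary.Unique.Propositional.Properties as Unique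
open import Data.Nat as ℕ using (ℕ; zero; suc; _≥_; z≤n; s≤s)
import Data.Nat.Properties as ℕ
open import Algebra.Properties.CommutativeSemigroup ℕ.+-commutativeSemigroup
  using () renaming (interchange to +-interchange)
open import Data.Nat.ListAction using (sum)
import Data.Nat.Coprimality as Coprime
open import Data.Product using (∃; _×_; _,_; proj₁; proj₂)
open import Data.Rational using (mkℚ; _/_; _+_; _-_; _*_; _≤_; 0ℚ; 1ℚ; ½)
open import Data.Rational.Base using (*≤*)
open import Data.Rational.Properties
  using (_≤?_; normalize-coprime; ≤-trans; <⇒≤; ≰⇒>; +-monoʳ-≤; +-identityʳ; neg-antimono-≤)
open import Data.Sum as Sum using (_⊎_; inj₁; inj₂)
open import Data.Vec using ([]; _∷_; replicate; lookup; updateAt; tabulate)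
open import Data.Vec.Properties
  using (≡-dec; ∷-injectiveʳ; lookup∘updateAt; lookup∘updateAt′; tabulate∘lookup; tabulate-cong)
open import Relation.Nullary using (¬_; Dec; does; yes; no)
open import Relation.Nullary.Decidable using (dec-true; dec-false; map′; _→-dec_; _×-dec_)
open import Relation.Binary.PropositionalEquality
open import Function using (_$_; _∘_; id; case_of_)

1+s≰1 : ∀ {s} → ½ ≤ s → ¬ (ℕ→ℚ 1 + s ≤ 1ℚ)
1+s≰1 ½≤s 1+s≤1 with ≤-trans (+-monoʳ-≤ (ℕ→ℚ 1) ½≤s) 1+s≤1
... | *≤* (ℤ.+≤+ (s≤s (s≤s ())))

-- (+ k) / 1 is stuck on a gcd computation when k is a variable.
ℕ→ℚ≡mkℚ : ∀ k → ℕ→ℚ k ≡ mkℚ (+ k) 0 (Coprime.sym (Coprime.1-coprimeTo k))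
ℕ→ℚ≡mkℚ k = normalize-coprime _

ℕ→ℚ≤1⇒≤1 : ∀ k → ℕ→ℚ k ≤ 1ℚ → k ℕ.≤ 1
ℕ→ℚ≤1⇒≤1 zero          _ = z≤n
ℕ→ℚ≤1⇒≤1 (suc zero)    _ = s≤s z≤n
ℕ→ℚ≤1⇒≤1 (suc (suc k)) k≤1 with subst (_≤ 1ℚ) (ℕ→ℚ≡mkℚ (suc (suc k))) k≤1
... | *≤* (ℤ.+≤+ (s≤s ()))

ℕ→ℚ+s≤1⇒≤1 : ∀ k {s} → 0ℚ ≤ s → ℕ→ℚ k + s ≤ 1ℚ → k ℕ.≤ 1
ℕ→ℚ+s≤1⇒≤1 k {s} 0≤s k+s≤1 = ℕ→ℚ≤1⇒≤1 k (≤-trans k≤k+s k+s≤1)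
  where
  k≤k+s : ℕ→ℚ k ≤ ℕ→ℚ k + s
  k≤k+s = subst (_≤ ℕ→ℚ k + s) (+-identityʳ (ℕ→ℚ k)) (+-monoʳ-≤ (ℕ→ℚ k) 0≤s)

0≤1-t : ∀ {t} → t ≤ 1ℚ → 0ℚ ≤ 1ℚ - t
0≤1-t t≤1 = +-monoʳ-≤ 1ℚ (neg-antimono-≤ t≤1)

½≤1-t : ∀ {t} → t ≤ ½ → ½ ≤ 1ℚ - t
½≤1-t t≤½ = +-monoʳ-≤ 1ℚ (neg-antimono-≤ t≤½)

≢⇒≡not : ∀ {a b} → a ≢ b → a ≡ not b
≢⇒≡not {true}  {true}  a≢b = ⊥-elim (a≢b refl)
≢⇒≡not {true}  {false} _   = refl
≢⇒≡not {false} {true}  _   = refl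
≢⇒≡not {false} {false} a≢b = ⊥-elim (a≢b refl)

module _ {n : ℕ} where

  _≟ᵥ_ : (u w : V n) → Dec (u ≡ w)
  _≟ᵥ_ = ≡-dec Bool._≟_

  lookup-ext : (u w : V n) → (∀ i → lookup u i ≡ lookup w i) → u ≡ w
  lookup-ext u w u≗w = begin
    u                ≡⟨ tabulate∘lookup u ⟨
    tabulate (lookup u) ≡⟨ tabulate-cong u≗w ⟩
    tabulate (lookup w) ≡⟨ tabulate∘lookup w ⟩
    w                ∎
    where open ≡-Reasoning

  flip : Fin n → V n → V n
  flip i v = updateAt v i not

  Adj-sym : {u w : V n} → Adj u w → Adj w u
  Adj-sym (i , uᵢ≢wᵢ , u≡w) = i , (λ e → uᵢ≢wᵢ (sym e)) , (λ j j≢i → sym (u≡w j j≢i))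

  Adj-flip : ∀ i v → Adj (flip i v) v
  Adj-flip i v = i , flipped , (λ j j≢i → lookup∘updateAt′ j i j≢i v)
    where
    flipped : lookup (flip i v) i ≢ lookup v i
    flipped e = not-¬ refl (trans (sym e) (lookup∘updateAt i v))

  Adj⇒flip : {u v : V n} → Adj u v → ∃ λ i → u ≡ flip i v
  Adj⇒flip {u} {v} (i , uᵢ≢vᵢ , u≡v) = i , lookup-ext u (flip i v) coordinates
    where
    coordinates : ∀ j → lookup u j ≡ lookup (flip i v) j
    coordinates j with j Fin.≟ i
    ... | yes refl = trans (≢⇒≡not uᵢ≢vᵢ) (sym (lookup∘updateAt i v))
    ... | no j≢i = trans (u≡v j j≢i) (sym (lookup∘updateAt′ j i j≢i v))

  flip-injective : ∀ v {i j} → flip i v ≡ flip j v → i ≡ j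
  flip-injective v {i} {j} e with i Fin.≟ j
  ... | yes i≡j = i≡j
  ... | no  i≢j = ⊥-elim (proj₁ (proj₂ (Adj-flip i v)) (begin
    lookup (flip i v) i ≡⟨ cong (λ w → lookup w i) e ⟩
    lookup (flip j v) i ≡⟨ lookup∘updateAt′ i j i≢j v ⟩
    lookup v i          ∎))
    where open ≡-Reasoning

  infix 4 _∈N[_]

  _∈N[_] : V n → V n → Set
  u ∈N[ c ] = u ≡ c ⊎ Adj u c

  closedNbhd : V n → List (V n)
  closedNbhd v = v ∷ map (λ i → flip i v) (allFin n)

  ∈closedNbhd⇒∈N[] : ∀ {u v} → u ∈ closedNbhd v → u ∈N[ v ]
  ∈closedNbhd⇒∈N[] (here u≡v) = inj₁ u≡v
  ∈closedNbhd⇒∈N[] {v = v} (there u∈) with ∈-map⁻ (λ i → flip i v) u∈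
  ... | i , _ , refl = inj₂ (Adj-flip i v)

  ∈N[]⇒∈closedNbhd : ∀ {u v} → u ∈N[ v ] → u ∈ closedNbhd v
  ∈N[]⇒∈closedNbhd (inj₁ u≡v) = here u≡v
  ∈N[]⇒∈closedNbhd {u} {v} (inj₂ u~v) with Adj⇒flip {u} {v} u~v
  ... | i , refl = there (∈-map⁺ (λ i → flip i v) (∈-allFin i))

  closedNbhd-unique : ∀ v → Unique (closedNbhd v)
  closedNbhd-unique v =
    All.tabulate centre≢flip ∷ Unique.map⁺ (flip-injective v) (Unique.allFin⁺ n)
    where
    centre≢flip : ∀ {u} → u ∈ map (λ i → flip i v) (allFin n) → v ≢ u
    centre≢flip u∈ v≡u with ∈-map⁻ (λ i → flip i v) u∈
    ... | i , _ , refl = proj₁ (proj₂ (Adj-flip i v)) (cong (λ w → lookup w i) (sym v≡u))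

  ∈N[]-differs-once : ∀ {u c i j} → u ∈N[ c ] →
    lookup u i ≢ lookup c i → lookup u j ≢ lookup c j → i ≡ j
  ∈N[]-differs-once (inj₁ refl) uᵢ≢cᵢ _ = ⊥-elim (uᵢ≢cᵢ refl)
  ∈N[]-differs-once {i = i} {j} (inj₂ (k , _ , u≡c)) uᵢ≢cᵢ uⱼ≢cⱼ with i Fin.≟ k | j Fin.≟ k
  ... | yes refl | yes refl = refl
  ... | no  i≢k  | _        = ⊥-elim (uᵢ≢cᵢ (u≡c i i≢k))
  ... | _        | no  j≢k  = ⊥-elim (uⱼ≢cⱼ (u≡c j j≢k))

  ∈N[]-same-flip : ∀ {c u w} i → u ∈N[ c ] → w ∈N[ c ] →
    lookup u i ≢ lookup c i → lookup w i ≢ lookup c i → u ≡ w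
  ∈N[]-same-flip {c} {u} {w} i u∈ w∈ uᵢ≢cᵢ wᵢ≢cᵢ = lookup-ext u w coordinates
    where
    coordinates : ∀ j → lookup u j ≡ lookup w j
    coordinates j with j Fin.≟ i
    ... | yes refl = other-value uᵢ≢cᵢ wᵢ≢cᵢ
      where
      other-value : ∀ {a b c : Bool} → a ≢ c → b ≢ c → a ≡ b
      other-value {true}  {true}  _ _ = refl
      other-value {false} {false} _ _ = refl
      other-value {true}  {false} {true}  a≢c _   = ⊥-elim (a≢c refl)
      other-value {true}  {false} {false} _   b≢c = ⊥-elim (b≢c refl)
      other-value {false} {true}  {true}  _   b≢c = ⊥-elim (b≢c refl)
      other-value {false} {true}  {false} a≢c _   = ⊥-elim (a≢c refl)
    ... | no j≢i with lookup u j Bool.≟ lookup c j | lookup w j Bool.≟ lookup c j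
    ...   | yes uⱼ≡cⱼ | yes wⱼ≡cⱼ = trans uⱼ≡cⱼ (sym wⱼ≡cⱼ)
    ...   | no  uⱼ≢cⱼ | _         = ⊥-elim (j≢i (∈N[]-differs-once u∈ uⱼ≢cⱼ uᵢ≢cᵢ))
    ...   | _         | no  wⱼ≢cⱼ = ⊥-elim (j≢i (∈N[]-differs-once w∈ wⱼ≢cⱼ wᵢ≢cᵢ))

  -- At a coordinate i where v and w differ, each common neighbour differs at i
  -- from v or from w; two of three land on the same side and must coincide.
  three-common-neighbours⇒≡ : ∀ {v w x y z} → x ≢ y → x ≢ z → y ≢ z →
    x ∈N[ v ] → y ∈N[ v ] → z ∈N[ v ] → x ∈N[ w ] → y ∈N[ w ] → z ∈N[ w ] → v ≡ w
  three-common-neighbours⇒≡ {v} {w} {x} {y} {z} x≢y x≢z y≢z xv yv zv xw yw zw =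
    lookup-ext v w coordinates
    where
    coordinates : ∀ i → lookup v i ≡ lookup w i
    coordinates i with lookup v i Bool.≟ lookup w i
    ... | yes vᵢ≡wᵢ = vᵢ≡wᵢ
    ... | no  vᵢ≢wᵢ = ⊥-elim (pigeonhole (side x) (side y) (side z))
      where
      Side : V n → Set
      Side p = (lookup p i ≢ lookup v i) ⊎ (lookup p i ≢ lookup w i)
      side : ∀ p → Side p
      side p with lookup p i Bool.≟ lookup v i
      ... | no  pᵢ≢vᵢ = inj₁ pᵢ≢vᵢ
      ... | yes pᵢ≡vᵢ = inj₂ (λ pᵢ≡wᵢ → vᵢ≢wᵢ (trans (sym pᵢ≡vᵢ) pᵢ≡wᵢ))
      pigeonhole : Side x → Side y → Side z → ⊥
      pigeonhole (inj₁ a) (inj₁ b) _        = x≢y (∈N[]-same-flip i xv yv a b)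
      pigeonhole (inj₂ a) (inj₂ b) _        = x≢y (∈N[]-same-flip i xw yw a b)
      pigeonhole (inj₁ a) _        (inj₁ c) = x≢z (∈N[]-same-flip i xv zv a c)
      pigeonhole (inj₂ a) _        (inj₂ c) = x≢z (∈N[]-same-flip i xw zw a c)
      pigeonhole _        (inj₁ b) (inj₁ c) = y≢z (∈N[]-same-flip i yv zv b c)
      pigeonhole _        (inj₂ b) (inj₂ c) = y≢z (∈N[]-same-flip i yw zw b c)

Čech₂ : (n : ℕ) → Complex n
Čech₂ n = Cech n ((+ 2) / 1)

module _ {n : ℕ} where

  _⊆N[_] : VSet n → V n → Set
  τ ⊆N[ c ] = ∀ u → u ∈ₛ τ → u ∈N[ c ]

  Walk≤1⇒∈N[] : ∀ {v x : V n} {k} → Walk v x k → k ℕ.≤ 1 → v ∈N[ x ]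
  Walk≤1⇒∈N[] nil                 _         = inj₁ refl
  Walk≤1⇒∈N[] (cons v~x nil)      _         = inj₂ v~x
  Walk≤1⇒∈N[] (cons _ (cons _ _)) (s≤s ())

  -- A point at parameter t of the edge ab is within distance 1 of u only if
  -- u ∈ N[a] (when t ≤ ½) or u ∈ N[b] (when t > ½).
  Čech₂⇒⊆N[] : ∀ {τ} → Čech₂ n τ → ∃ λ c → τ ⊆N[ c ]
  Čech₂⇒⊆N[] (_ , vtx c , ball) = c , λ u u∈τ →
    let k , walk , k≤1 = ball u u∈τ in Walk≤1⇒∈N[] walk (ℕ→ℚ≤1⇒≤1 k k≤1)
  Čech₂⇒⊆N[] {τ} (_ , onEdge a b a~b t 0≤t t≤1 , ball) with t ≤? ½
  ... | yes t≤½ = a , near-a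
    where
    near-a : ∀ u → u ∈ₛ τ → u ∈N[ a ]
    near-a u u∈τ with ball u u∈τ
    ... | inj₁ (k , walk , k+t≤1)              = Walk≤1⇒∈N[] walk (ℕ→ℚ+s≤1⇒≤1 k 0≤t k+t≤1)
    ... | inj₂ (zero , nil , _)                = inj₂ (Adj-sym {u = a} {w = u} a~b)
    ... | inj₂ (suc zero , _ , 1+1-t≤1)        = ⊥-elim (1+s≰1 (½≤1-t t≤½) 1+1-t≤1)
    ... | inj₂ (suc (suc k) , _ , k+1-t≤1) with ℕ→ℚ+s≤1⇒≤1 (suc (suc k)) (0≤1-t t≤1) k+1-t≤1
    ...   | s≤s ()
  ... | no t≰½ = b , near-b
    where
    near-b : ∀ u → u ∈ₛ τ → u ∈N[ b ]
    near-b u u∈τ with ball u u∈τ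
    ... | inj₂ (k , walk , k+1-t≤1)            = Walk≤1⇒∈N[] walk (ℕ→ℚ+s≤1⇒≤1 k (0≤1-t t≤1) k+1-t≤1)
    ... | inj₁ (zero , nil , _)                = inj₂ a~b
    ... | inj₁ (suc zero , _ , 1+t≤1)          = ⊥-elim (1+s≰1 (<⇒≤ (≰⇒> t≰½)) 1+t≤1)
    ... | inj₁ (suc (suc k) , _ , k+t≤1) with ℕ→ℚ+s≤1⇒≤1 (suc (suc k)) 0≤t k+t≤1
    ...   | s≤s ()

  ⊆N[]⇒Čech₂ : ∀ {τ} c → NonEmpty τ → τ ⊆N[ c ] → Čech₂ n τ
  ⊆N[]⇒Čech₂ {τ} c τ≢∅ τ⊆N[c] = τ≢∅ , vtx c , within-1
    where
    within-1 : ∀ u → u ∈ₛ τ → InBall u ((+ 2) / 1 * ½) (vtx c)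
    within-1 u u∈τ with τ⊆N[c] u u∈τ
    ... | inj₁ refl = 0 , nil , *≤* (ℤ.+≤+ z≤n)
    ... | inj₂ u~c  = 1 , cons u~c nil , *≤* (ℤ.+≤+ (s≤s z≤n))

does-true⇒ : ∀ {A : Set} (a? : Dec A) → does a? ≡ true → A
does-true⇒ (yes a) _ = a

≡true⇒≢false : ∀ {b} → b ≡ true → b ≢ false
≡true⇒≢false refl ()

≢true⇒≡false : ∀ {b} → b ≢ true → b ≡ false
≢true⇒≡false {true}  b≢true = ⊥-elim (b≢true refl)
≢true⇒≡false {false} _      = refl

∨-≡true⁻ : ∀ a {b} → a ∨ b ≡ true → a ≡ true ⊎ b ≡ true
∨-≡true⁻ true  _ = inj₁ refl
∨-≡true⁻ false b = inj₂ b

∨-≡trueˡ : ∀ {a} b → a ≡ true → a ∨ b ≡ true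
∨-≡trueˡ _ refl = refl

∨-≡trueʳ : ∀ a {b} → b ≡ true → a ∨ b ≡ true
∨-≡trueʳ true  _ = refl
∨-≡trueʳ false b = b

∧-≡true⁻ : ∀ a {b} → a ∧ b ≡ true → a ≡ true × b ≡ true
∧-≡true⁻ true b = refl , b

∧-≡true⁺ : ∀ {a b} → a ≡ true → b ≡ true → a ∧ b ≡ true
∧-≡true⁺ refl refl = refl

module _ {n : ℕ} where

  open import Data.List.Membership.DecPropositional (_≟ᵥ_ {n}) using (_∈?_)

  ∅ₛ : VSet n
  ∅ₛ _ = false

  singleton : V n → VSet n
  singleton x u = does (u ≟ᵥ x)

  _∪ₛ_ : VSet n → VSet n → VSet n
  (P ∪ₛ Q) u = P u ∨ Q u

  insert : V n → VSet n → VSet n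
  insert x P = singleton x ∪ₛ P

  fromList : List (V n) → VSet n
  fromList L u = does (u ∈? L)

  ⊆ₛ-refl : {P : VSet n} → P ⊆ₛ P
  ⊆ₛ-refl _ u∈P = u∈P

  ⊆ₛ-trans : {P Q S : VSet n} → P ⊆ₛ Q → Q ⊆ₛ S → P ⊆ₛ S
  ⊆ₛ-trans P⊆Q Q⊆S u u∈P = Q⊆S u (P⊆Q u u∈P)

  ∈-insert⁻ : ∀ {x P} u → u ∈ₛ insert x P → u ≡ x ⊎ u ∈ₛ P
  ∈-insert⁻ {x} u u∈ with ∨-≡true⁻ (does (u ≟ᵥ x)) u∈
  ... | inj₁ u≡x = inj₁ (does-true⇒ (u ≟ᵥ x) u≡x)
  ... | inj₂ u∈P = inj₂ u∈P

  x∈insert : ∀ x {P} → x ∈ₛ insert x P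
  x∈insert x = ∨-≡trueˡ _ (dec-true (x ≟ᵥ x) refl)

  ⊆insert : ∀ x {P} → P ⊆ₛ insert x P
  ⊆insert x u = ∨-≡trueʳ (does (u ≟ᵥ x))

  insert-⊆ : ∀ {x P δ} → x ∈ₛ δ → P ⊆ₛ δ → insert x P ⊆ₛ δ
  insert-⊆ {x} {P} x∈δ P⊆δ u u∈ with ∈-insert⁻ {x} {P} u u∈
  ... | inj₁ refl = x∈δ
  ... | inj₂ u∈P  = P⊆δ u u∈P

  ∉-insert : ∀ {x y P} → y ≢ x → P y ≡ false → insert x P y ≡ false
  ∉-insert {x} {y} y≢x Py≡false rewrite dec-false (y ≟ᵥ x) y≢x = Py≡false

  ∈fromList⁺ : ∀ {L u} → u ∈ L → u ∈ₛ fromList L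
  ∈fromList⁺ {L} {u} = dec-true (u ∈? L)

  ∈fromList⁻ : ∀ {L u} → u ∈ₛ fromList L → u ∈ L
  ∈fromList⁻ {L} {u} = does-true⇒ (u ∈? L)

  ∈-∪⁻ : ∀ P Q u → u ∈ₛ (P ∪ₛ Q) → u ∈ₛ P ⊎ u ∈ₛ Q
  ∈-∪⁻ P Q u = ∨-≡true⁻ (P u)

  ⊆-∪ˡ : ∀ P Q → P ⊆ₛ (P ∪ₛ Q)
  ⊆-∪ˡ P Q u = ∨-≡trueˡ (Q u)

  ⊆-∪ʳ : ∀ P Q → Q ⊆ₛ (P ∪ₛ Q)
  ⊆-∪ʳ P Q u = ∨-≡trueʳ (P u)

  ∈allV : ∀ v → v ∈ allV n
  ∈allV = ∈allV′
    where
    ∈allV′ : ∀ {m} (v : V m) → v ∈ allV m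
    ∈allV′ []                = here refl
    ∈allV′ {suc m} (true ∷ v)  = ∈-++⁺ˡ (∈-map⁺ (true ∷_) (∈allV′ v))
    ∈allV′ {suc m} (false ∷ v) = ∈-++⁺ʳ (map (true ∷_) (allV m)) (∈-map⁺ (false ∷_) (∈allV′ v))

allV-unique : ∀ n → Unique (allV n)
allV-unique zero    = [] ∷ []
allV-unique (suc n) =
  Unique.++⁺ (Unique.map⁺ ∷-injectiveʳ (allV-unique n)) (Unique.map⁺ ∷-injectiveʳ (allV-unique n))
             disjoint
  where
  disjoint : ∀ {v} → ¬ (v ∈ map (true ∷_) (allV n) × v ∈ map (false ∷_) (allV n))
  disjoint (v∈₁ , v∈₂) with ∈-map⁻ (true ∷_) v∈₁ | ∈-map⁻ (false ∷_) v∈₂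
  ... | _ , _ , refl | _ , _ , ()

module _ {A : Set} (f g : A → ℕ) where

  sum-map-mono : ∀ L → (∀ x → f x ℕ.≤ g x) → sum (map f L) ℕ.≤ sum (map g L)
  sum-map-mono []      _   = z≤n
  sum-map-mono (x ∷ L) f≤g = ℕ.+-mono-≤ (f≤g x) (sum-map-mono L f≤g)

  sum-map-mono-< : ∀ {L x} → (∀ y → f y ℕ.≤ g y) → x ∈ L → f x ℕ.< g x →
    sum (map f L) ℕ.< sum (map g L)
  sum-map-mono-< {y ∷ L} f≤g (here refl) fx<gx = ℕ.+-mono-<-≤ fx<gx (sum-map-mono L f≤g)
  sum-map-mono-< {y ∷ L} f≤g (there x∈L) fx<gx = ℕ.+-mono-≤-< (f≤g y) (sum-map-mono-< f≤g x∈L fx<gx)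

  sum-map-+ : ∀ L → sum (map (λ x → f x ℕ.+ g x) L) ≡ sum (map f L) ℕ.+ sum (map g L)
  sum-map-+ []      = refl
  sum-map-+ (x ∷ L) = begin
    f x ℕ.+ g x ℕ.+ sum (map (λ x → f x ℕ.+ g x) L)    ≡⟨ cong (f x ℕ.+ g x ℕ.+_) (sum-map-+ L) ⟩
    f x ℕ.+ g x ℕ.+ (sum (map f L) ℕ.+ sum (map g L))  ≡⟨ +-interchange (f x) (g x) _ _ ⟩
    f x ℕ.+ sum (map f L) ℕ.+ (g x ℕ.+ sum (map g L))  ∎
    where open ≡-Reasoning

sum-map-≡0 : ∀ {A : Set} (f : A → ℕ) L → (∀ x → x ∈ L → f x ≡ 0) → sum (map f L) ≡ 0
sum-map-≡0 f []      _    = refl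
sum-map-≡0 f (x ∷ L) f≡0 rewrite f≡0 x (here refl) = sum-map-≡0 f L (λ y y∈L → f≡0 y (there y∈L))

sum-map-≤length : ∀ {A : Set} (f : A → ℕ) L → (∀ x → f x ℕ.≤ 1) → sum (map f L) ℕ.≤ length L
sum-map-≤length f []      _    = z≤n
sum-map-≤length f (x ∷ L) f≤1 = ℕ.+-mono-≤ (f≤1 x) (sum-map-≤length f L f≤1)

module _ {n : ℕ} where

  indicator : VSet n → V n → ℕ
  indicator σ v = if σ v then 1 else 0

  indicator≤1 : ∀ σ v → indicator σ v ℕ.≤ 1
  indicator≤1 σ v with σ v
  ... | true  = s≤s z≤n
  ... | false = z≤n

  indicator-mono : ∀ {P Q} → P ⊆ₛ Q → ∀ v → indicator P v ℕ.≤ indicator Q v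
  indicator-mono {P} P⊆Q v with P v in Pv
  ... | false = z≤n
  ... | true rewrite P⊆Q v Pv = s≤s z≤n

  indicator-∪ : ∀ P Q v → indicator (P ∪ₛ Q) v ℕ.≤ indicator P v ℕ.+ indicator Q v
  indicator-∪ P Q v with P v | Q v
  ... | true  | _     = s≤s z≤n
  ... | false | true  = s≤s z≤n
  ... | false | false = z≤n

  card-mono : ∀ {P Q} → P ⊆ₛ Q → card P ℕ.≤ card Q
  card-mono P⊆Q = sum-map-mono _ _ (allV n) (indicator-mono P⊆Q)

  card-⊂ : ∀ {P Q} v → P ⊆ₛ Q → v ∈ₛ Q → P v ≡ false → card P ℕ.< card Q
  card-⊂ {P} {Q} v P⊆Q v∈Q v∉P =
    sum-map-mono-< (indicator P) (indicator Q) (indicator-mono P⊆Q) (∈allV v) 0<1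
    where
    0<1 : indicator P v ℕ.< indicator Q v
    0<1 rewrite v∉P | v∈Q = s≤s z≤n

  card-∪ : ∀ P Q → card (P ∪ₛ Q) ℕ.≤ card P ℕ.+ card Q
  card-∪ P Q = ℕ.≤-trans (sum-map-mono _ _ (allV n) (indicator-∪ P Q))
                         (ℕ.≤-reflexive (sum-map-+ (indicator P) (indicator Q) (allV n)))

  card≤∣allV∣ : ∀ P → card P ℕ.≤ length (allV n)
  card≤∣allV∣ P = sum-map-≤length (indicator P) (allV n) (indicator≤1 P)

  card-∅ : card (∅ₛ {n}) ≡ 0
  card-∅ = sum-map-≡0 (indicator ∅ₛ) (allV n) (λ _ _ → refl)

  card-singleton : ∀ x → card (singleton x) ℕ.≤ 1
  card-singleton x = count≤1 (allV-unique n)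
    where
    count≤1 : ∀ {L} → Unique L → sum (map (indicator (singleton x)) L) ℕ.≤ 1
    count≤1 {[]}    _            = z≤n
    count≤1 {y ∷ L} (y∉L ∷ uniq) with y ≟ᵥ x
    ... | no  _    = count≤1 uniq
    ... | yes refl = ℕ.≤-reflexive (cong suc (sum-map-≡0 _ L others))
      where
      others : ∀ u → u ∈ L → indicator (singleton x) u ≡ 0
      others u u∈L rewrite dec-false (u ≟ᵥ x) (λ u≡x → All.lookup y∉L u∈L (sym u≡x)) = refl

  card-insert : ∀ x P → card (insert x P) ℕ.≤ suc (card P)
  card-insert x P = ℕ.≤-trans (card-∪ (singleton x) P) (ℕ.+-monoˡ-≤ (card P) (card-singleton x))

  card-insert-+ : ∀ x P {k d} → card P ℕ.+ suc k ℕ.≤ d → card (insert x P) ℕ.+ k ℕ.≤ d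
  card-insert-+ x P {k} ∣P∣+1+k≤d = begin
    card (insert x P) ℕ.+ k  ≤⟨ ℕ.+-monoˡ-≤ k (card-insert x P) ⟩
    suc (card P) ℕ.+ k       ≡⟨ ℕ.+-suc (card P) k ⟨
    card P ℕ.+ suc k         ≤⟨ ∣P∣+1+k≤d ⟩
    _                        ∎
    where open ℕ.≤-Reasoning

  card-three : ∀ {σ a b c} → a ≢ b → a ≢ c → b ≢ c → a ∈ₛ σ → b ∈ₛ σ → c ∈ₛ σ → 3 ℕ.≤ card σ
  card-three {σ} {a} {b} {c} a≢b a≢c b≢c a∈σ b∈σ c∈σ = begin
    3                              ≤⟨ s≤s (s≤s (s≤s z≤n)) ⟩
    3 ℕ.+ card (∅ₛ {n})            ≤⟨ s≤s (s≤s (card-⊂ a (λ _ ()) (x∈insert a) refl)) ⟩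
    2 ℕ.+ card {n} A               ≤⟨ s≤s (card-⊂ b (⊆insert b {A}) (x∈insert b {A}) b∉A) ⟩
    1 ℕ.+ card B                   ≤⟨ card-⊂ c (⊆insert c {B}) (x∈insert c {B}) c∉B ⟩
    card (insert c B)              ≤⟨ card-mono (insert-⊆ c∈σ (insert-⊆ b∈σ (insert-⊆ a∈σ (λ _ ())))) ⟩
    card σ                         ∎
    where
    open ℕ.≤-Reasoning
    A B : VSet n
    A = insert a ∅ₛ
    B = insert b A
    b∉A : A b ≡ false
    b∉A = ∉-insert {P = ∅ₛ} (≢-sym a≢b) refl
    c∉B : B c ≡ false
    c∉B = ∉-insert {P = A} (≢-sym b≢c) (∉-insert {P = ∅ₛ} (≢-sym a≢c) refl)

module _ {n : ℕ} where

  HasAtLeast : ℕ → List (V n) → VSet n → Set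
  HasAtLeast zero    L       τ = ⊤
  HasAtLeast (suc k) []      τ = ⊥
  HasAtLeast (suc k) (x ∷ L) τ = (x ∈ₛ τ × HasAtLeast k L τ) ⊎ HasAtLeast (suc k) L τ

  HasAtLeast-pred : ∀ {k L τ} → HasAtLeast (suc k) L τ → HasAtLeast k L τ
  HasAtLeast-pred {zero}          _               = tt
  HasAtLeast-pred {suc k} {x ∷ L} (inj₁ (x∈ , h)) = inj₁ (x∈ , HasAtLeast-pred h)
  HasAtLeast-pred {suc k} {x ∷ L} (inj₂ h)        = inj₂ (HasAtLeast-pred h)

  HasAtLeast-tail : ∀ {k x L τ} → HasAtLeast (suc k) (x ∷ L) τ → HasAtLeast k L τ
  HasAtLeast-tail (inj₁ (_ , h)) = h
  HasAtLeast-tail (inj₂ h)       = HasAtLeast-pred h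

  HasAtLeast-skip : ∀ {k x L τ} → ¬ x ∈ₛ τ → HasAtLeast (suc k) (x ∷ L) τ → HasAtLeast (suc k) L τ
  HasAtLeast-skip x∉τ (inj₁ (x∈τ , _)) = ⊥-elim (x∉τ x∈τ)
  HasAtLeast-skip x∉τ (inj₂ h)         = h

  record Pair (L : List (V n)) (τ : VSet n) : Set where
    constructor pair
    field
      {x y}    : V n
      x≢y      : x ≢ y
      x∈L      : x ∈ L
      y∈L      : y ∈ L
      x∈τ      : x ∈ₛ τ
      y∈τ      : y ∈ₛ τ

  record Triple (L : List (V n)) (τ : VSet n) : Set where
    constructor triple
    field
      {x y z}  : V n
      x≢y      : x ≢ y
      x≢z      : x ≢ z
      y≢z      : y ≢ z
      x∈L      : x ∈ L
      y∈L      : y ∈ L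
      z∈L      : z ∈ L
      x∈τ      : x ∈ₛ τ
      y∈τ      : y ∈ₛ τ
      z∈τ      : z ∈ₛ τ

  HasAtLeast1⁺ : ∀ {L τ a} → a ∈ L → a ∈ₛ τ → HasAtLeast 1 L τ
  HasAtLeast1⁺ (here refl) a∈τ = inj₁ (a∈τ , tt)
  HasAtLeast1⁺ (there a∈L) a∈τ = inj₂ (HasAtLeast1⁺ a∈L a∈τ)

  HasAtLeast2⁺ : ∀ {L τ} → Pair L τ → HasAtLeast 2 L τ
  HasAtLeast2⁺ (pair x≢y (here refl) (here refl) _ _) = ⊥-elim (x≢y refl)
  HasAtLeast2⁺ (pair x≢y (here refl) (there y∈L) x∈τ y∈τ) = inj₁ (x∈τ , HasAtLeast1⁺ y∈L y∈τ)
  HasAtLeast2⁺ (pair x≢y (there x∈L) (here refl) x∈τ y∈τ) = inj₁ (y∈τ , HasAtLeast1⁺ x∈L x∈τ)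
  HasAtLeast2⁺ (pair x≢y (there x∈L) (there y∈L) x∈τ y∈τ) =
    inj₂ (HasAtLeast2⁺ (pair x≢y x∈L y∈L x∈τ y∈τ))

  HasAtLeast3⁺ : ∀ {L τ} → Triple L τ → HasAtLeast 3 L τ
  HasAtLeast3⁺ (triple x≢y _ _ (here refl) (here refl) _ _ _ _) = ⊥-elim (x≢y refl)
  HasAtLeast3⁺ (triple _ x≢z _ (here refl) (there _) (here refl) _ _ _) = ⊥-elim (x≢z refl)
  HasAtLeast3⁺ (triple _ _ y≢z (there _) (here refl) (here refl) _ _ _) = ⊥-elim (y≢z refl)
  HasAtLeast3⁺ (triple _ _ y≢z (here refl) (there y∈L) (there z∈L) x∈τ y∈τ z∈τ) =
    inj₁ (x∈τ , HasAtLeast2⁺ (pair y≢z y∈L z∈L y∈τ z∈τ))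
  HasAtLeast3⁺ (triple _ x≢z _ (there x∈L) (here refl) (there z∈L) x∈τ y∈τ z∈τ) =
    inj₁ (y∈τ , HasAtLeast2⁺ (pair x≢z x∈L z∈L x∈τ z∈τ))
  HasAtLeast3⁺ (triple x≢y _ _ (there x∈L) (there y∈L) (here refl) x∈τ y∈τ z∈τ) =
    inj₁ (z∈τ , HasAtLeast2⁺ (pair x≢y x∈L y∈L x∈τ y∈τ))
  HasAtLeast3⁺ (triple x≢y x≢z y≢z (there x∈L) (there y∈L) (there z∈L) x∈τ y∈τ z∈τ) =
    inj₂ (HasAtLeast3⁺ (triple x≢y x≢z y≢z x∈L y∈L z∈L x∈τ y∈τ z∈τ))

  HasAtLeast-suc⁻ : ∀ {k L τ} → HasAtLeast (suc k) L τ → ∃ λ a → a ∈ L × a ∈ₛ τ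
  HasAtLeast-suc⁻ {L = x ∷ L} (inj₁ (x∈τ , _)) = x , here refl , x∈τ
  HasAtLeast-suc⁻ {L = x ∷ L} (inj₂ h) = let a , a∈L , a∈τ = HasAtLeast-suc⁻ h in a , there a∈L , a∈τ

  HasAtLeast2⁻ : ∀ {L τ} → Unique L → HasAtLeast 2 L τ → Pair L τ
  HasAtLeast2⁻ {x ∷ L} (x∉L ∷ _) (inj₁ (x∈τ , h)) =
    let a , a∈L , a∈τ = HasAtLeast-suc⁻ h in pair (All.lookup x∉L a∈L) (here refl) (there a∈L) x∈τ a∈τ
  HasAtLeast2⁻ {x ∷ L} (_ ∷ uniq) (inj₂ h) with HasAtLeast2⁻ uniq h
  ... | pair x≢y x∈L y∈L x∈τ y∈τ = pair x≢y (there x∈L) (there y∈L) x∈τ y∈τ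

  HasAtLeast3⁻ : ∀ {L τ} → Unique L → HasAtLeast 3 L τ → Triple L τ
  HasAtLeast3⁻ {x ∷ L} (x∉L ∷ uniq) (inj₁ (x∈τ , h)) with HasAtLeast2⁻ uniq h
  ... | pair y≢z y∈L z∈L y∈τ z∈τ =
    triple (All.lookup x∉L y∈L) (All.lookup x∉L z∈L) y≢z (here refl) (there y∈L) (there z∈L) x∈τ y∈τ z∈τ
  HasAtLeast3⁻ {x ∷ L} (_ ∷ uniq) (inj₂ h) with HasAtLeast3⁻ uniq h
  ... | triple x≢y x≢z y≢z x∈L y∈L z∈L x∈τ y∈τ z∈τ =
    triple x≢y x≢z y≢z (there x∈L) (there y∈L) (there z∈L) x∈τ y∈τ z∈τ

module _ {n : ℕ} where

  private
    variable
      x : V n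
      P δ : VSet n
      L : List (V n)

  ⊆-∪-shiftʳ : ∀ x P L → δ ⊆ₛ (insert x P ∪ₛ fromList L) → δ ⊆ₛ (P ∪ₛ fromList (x ∷ L))
  ⊆-∪-shiftʳ x P L δ⊆ u u∈δ with ∈-∪⁻ (insert x P) (fromList L) u (δ⊆ u u∈δ)
  ... | inj₂ u∈L = ⊆-∪ʳ P (fromList (x ∷ L)) u (⊆insert x {P = fromList L} u u∈L)
  ... | inj₁ u∈xP with ∈-insert⁻ {x = x} {P = P} u u∈xP
  ...   | inj₁ refl = ⊆-∪ʳ P (fromList (x ∷ L)) u (x∈insert x {P = fromList L})
  ...   | inj₂ u∈P  = ⊆-∪ˡ P (fromList (x ∷ L)) u u∈P

  ⊆-∪-shiftˡ : ∀ x P L → δ ⊆ₛ (P ∪ₛ fromList (x ∷ L)) → δ ⊆ₛ (insert x P ∪ₛ fromList L)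
  ⊆-∪-shiftˡ x P L δ⊆ u u∈δ with ∈-∪⁻ P (fromList (x ∷ L)) u (δ⊆ u u∈δ)
  ... | inj₁ u∈P  = ⊆-∪ˡ (insert x P) (fromList L) u (⊆insert x {P = P} u u∈P)
  ... | inj₂ u∈xL with ∈-insert⁻ {x = x} {P = fromList L} u u∈xL
  ...   | inj₁ refl = ⊆-∪ˡ (insert x P) (fromList L) u (x∈insert x {P = P})
  ...   | inj₂ u∈L  = ⊆-∪ʳ (insert x P) (fromList L) u u∈L

  ⊆-∪-drop : ∀ x P L → δ x ≡ false → δ ⊆ₛ (P ∪ₛ fromList (x ∷ L)) → δ ⊆ₛ (P ∪ₛ fromList L)
  ⊆-∪-drop x P L x∉δ δ⊆ u u∈δ with ∈-∪⁻ P (fromList (x ∷ L)) u (δ⊆ u u∈δ)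
  ... | inj₁ u∈P  = ⊆-∪ˡ P (fromList L) u u∈P
  ... | inj₂ u∈xL with ∈-insert⁻ {x = x} {P = fromList L} u u∈xL
  ...   | inj₁ refl = ⊥-elim (≡true⇒≢false u∈δ x∉δ)
  ...   | inj₂ u∈L  = ⊆-∪ʳ P (fromList L) u u∈L

  -- Interval k P L δ: for some k-subset S of L, δ lies between P ∪ S and
  -- P ∪ S ∪ (the elements of L after the last element of S).
  Interval : ℕ → VSet n → List (V n) → VSet n → Set
  Interval zero    P L       δ = P ⊆ₛ δ × δ ⊆ₛ (P ∪ₛ fromList L)
  Interval (suc k) P []      δ = ⊥
  Interval (suc k) P (x ∷ L) δ = Interval k (insert x P) L δ ⊎ Interval (suc k) P L δ

  -- Extension k P L δ: δ is P together with exactly k elements of L.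
  Extension : ℕ → VSet n → List (V n) → VSet n → Set
  Extension zero    P L       δ = P ⊆ₛ δ × δ ⊆ₛ P
  Extension (suc k) P []      δ = ⊥
  Extension (suc k) P (x ∷ L) δ = Extension k (insert x P) L δ ⊎ Extension (suc k) P L δ

  Interval⁻ : ∀ k → Interval k P L δ →
    P ⊆ₛ δ × δ ⊆ₛ (P ∪ₛ fromList L) × HasAtLeast k L δ
  Interval⁻ zero (P⊆δ , δ⊆) = P⊆δ , δ⊆ , tt
  Interval⁻ {P = P} {L = x ∷ L} (suc k) (inj₁ i) =
    let xP⊆δ , δ⊆ , has = Interval⁻ k i
    in ⊆ₛ-trans (⊆insert x {P = P}) xP⊆δ , ⊆-∪-shiftʳ x P L δ⊆ , inj₁ (xP⊆δ x (x∈insert x {P = P}) , has)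
  Interval⁻ {P = P} {L = x ∷ L} (suc k) (inj₂ i) =
    let P⊆δ , δ⊆ , has = Interval⁻ (suc k) i
    in P⊆δ , ⊆ₛ-trans δ⊆ widen , inj₂ has
    where
    widen : (P ∪ₛ fromList L) ⊆ₛ (P ∪ₛ fromList (x ∷ L))
    widen u u∈ with ∈-∪⁻ P (fromList L) u u∈
    ... | inj₁ u∈P = ⊆-∪ˡ P (fromList (x ∷ L)) u u∈P
    ... | inj₂ u∈L = ⊆-∪ʳ P (fromList (x ∷ L)) u (⊆insert x {P = fromList L} u u∈L)

  Interval⁺ : ∀ k → P ⊆ₛ δ → δ ⊆ₛ (P ∪ₛ fromList L) → HasAtLeast k L δ → Interval k P L δ
  Interval⁺ zero            P⊆δ δ⊆ _ = P⊆δ , δ⊆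
  Interval⁺ {L = []} (suc k) _  _  ()
  Interval⁺ {P = P} {δ = δ} {L = x ∷ L} (suc k) P⊆δ δ⊆ has with δ x Bool.≟ true
  ... | yes x∈δ = inj₁ (Interval⁺ k (insert-⊆ x∈δ P⊆δ) (⊆-∪-shiftˡ x P L δ⊆) (HasAtLeast-tail has))
  ... | no  x∉δ = inj₂ (Interval⁺ (suc k) P⊆δ (⊆-∪-drop x P L (≢true⇒≡false x∉δ) δ⊆)
                                    (HasAtLeast-skip x∉δ has))

  Extension⁺ : ∀ k → P ⊆ₛ δ → δ ⊆ₛ (P ∪ₛ fromList L) →
    HasAtLeast k L δ → ¬ HasAtLeast (suc k) L δ → Extension k P L δ
  Extension⁺ {P = P} {L = L} zero P⊆δ δ⊆ _ ¬has = P⊆δ , δ⊆P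
    where
    δ⊆P : _ ⊆ₛ P
    δ⊆P u u∈δ with ∈-∪⁻ P (fromList L) u (δ⊆ u u∈δ)
    ... | inj₁ u∈P = u∈P
    ... | inj₂ u∈L = ⊥-elim (¬has (HasAtLeast1⁺ (∈fromList⁻ u∈L) u∈δ))
  Extension⁺ {L = []} (suc k) _ _ () _
  Extension⁺ {P = P} {δ = δ} {L = x ∷ L} (suc k) P⊆δ δ⊆ has ¬has with δ x Bool.≟ true
  ... | yes x∈δ = inj₁ (Extension⁺ k (insert-⊆ x∈δ P⊆δ) (⊆-∪-shiftˡ x P L δ⊆) (HasAtLeast-tail has)
                          (λ has′ → ¬has (inj₁ (x∈δ , has′))))
  ... | no  x∉δ = inj₂ (Extension⁺ (suc k) P⊆δ (⊆-∪-drop x P L (≢true⇒≡false x∉δ) δ⊆)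
                          (HasAtLeast-skip x∉δ has) (¬has ∘ inj₂))

  Extension⇒Interval : ∀ k → Extension k P L δ → Interval k P L δ
  Extension⇒Interval {P = P} {L = L} zero (P⊆δ , δ⊆P) = P⊆δ , ⊆ₛ-trans δ⊆P (⊆-∪ˡ P (fromList L))
  Extension⇒Interval {L = x ∷ L} (suc k) (inj₁ e) = inj₁ (Extension⇒Interval k e)
  Extension⇒Interval {L = x ∷ L} (suc k) (inj₂ e) = inj₂ (Extension⇒Interval (suc k) e)

module _ {n : ℕ} where

  private
    variable
      R R′ R₁ R₂ : VSet n → Bool
      F F₁ F₂ : VSet n → Set

  _⊆?_ : (σ τ : VSet n) → Dec (σ ⊆ₛ τ)
  σ ⊆? τ = map′ (λ all v → All.lookup all (∈allV v)) (λ σ⊆τ → All.tabulate (λ {v} _ → σ⊆τ v))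
                (All.all? (λ v → σ v Bool.≟ true →-dec τ v Bool.≟ true) (allV n))

  Between : VSet n → VSet n → VSet n → Set
  Between σ γ δ = σ ⊆ₛ δ × δ ⊆ₛ γ

  between? : ∀ σ γ δ → Dec (Between σ γ δ)
  between? σ γ δ = σ ⊆? δ ×-dec δ ⊆? γ

  _∖_ : Complex n → (VSet n → Bool) → Complex n
  (X ∖ R) δ = X δ × R δ ≡ false

  _≐_∪_ : (VSet n → Bool) → (VSet n → Bool) → (VSet n → Set) → Set
  R′ ≐ R ∪ F = ∀ δ → (R′ δ ≡ true → R δ ≡ true ⊎ F δ) × (R δ ≡ true ⊎ F δ → R′ δ ≡ true)

  _⊑_ : (VSet n → Bool) → (VSet n → Bool) → Set
  R ⊑ R′ = ∀ δ → R δ ≡ true → R′ δ ≡ true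

  ⋃ : ∀ {A : Set} → List A → (A → VSet n → Set) → VSet n → Set
  ⋃ as G δ = ∃ λ a → a ∈ as × G a δ

  Extensional : (VSet n → Set) → Set
  Extensional F = ∀ {δ δ′} → δ ⊆ₛ δ′ → δ′ ⊆ₛ δ → F δ → F δ′

  ≐-∪-⊥ : R ≐ R ∪ (λ _ → ⊥)
  ≐-∪-⊥ δ = inj₁ , λ { (inj₁ Rδ) → Rδ ; (inj₂ ()) }

  ≐-∪-assoc : R₁ ≐ R ∪ F₁ → R₂ ≐ R₁ ∪ F₂ → R₂ ≐ R ∪ (λ δ → F₁ δ ⊎ F₂ δ)
  ≐-∪-assoc R₁≐ R₂≐ δ =
    Sum.[ Sum.map₂ inj₁ ∘ proj₁ (R₁≐ δ) , inj₂ ∘ inj₂ ] ∘ proj₁ (R₂≐ δ) ,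
    proj₂ (R₂≐ δ) ∘ Sum.[ inj₁ ∘ proj₂ (R₁≐ δ) ∘ inj₁ , Sum.[ inj₁ ∘ proj₂ (R₁≐ δ) ∘ inj₂ , inj₂ ] ]

  ≐-∪-decidable : (F? : ∀ δ → Dec (F δ)) → (λ δ → R δ ∨ does (F? δ)) ≐ R ∪ F
  ≐-∪-decidable {R = R} F? δ =
    Sum.map₂ (does-true⇒ (F? δ)) ∘ ∨-≡true⁻ (R δ) , Sum.[ ∨-≡trueˡ _ , ∨-≡trueʳ (R δ) ∘ dec-true (F? δ) ]

  ≐-∪⇒⊑ : R′ ≐ R ∪ F → R ⊑ R′
  ≐-∪⇒⊑ R′≐ δ Rδ = proj₂ (R′≐ δ) (inj₁ Rδ)

  ≐-∪-removes : R′ ≐ R ∪ F → ∀ {δ} → F δ → R′ δ ≡ true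
  ≐-∪-removes R′≐ {δ} Fδ = proj₂ (R′≐ δ) (inj₂ Fδ)

  ⊑-trans : R ⊑ R₁ → R₁ ⊑ R₂ → R ⊑ R₂
  ⊑-trans R⊑R₁ R₁⊑R₂ δ Rδ = R₁⊑R₂ δ (R⊑R₁ δ Rδ)

  Extensional-≐ : Extensional (λ δ → R δ ≡ true) → Extensional F → R′ ≐ R ∪ F →
    Extensional (λ δ → R′ δ ≡ true)
  Extensional-≐ extR extF R′≐ δ⊆δ′ δ′⊆δ R′δ with proj₁ (R′≐ _) R′δ
  ... | inj₁ Rδ = proj₂ (R′≐ _) (inj₁ (extR δ⊆δ′ δ′⊆δ Rδ))
  ... | inj₂ Fδ = proj₂ (R′≐ _) (inj₂ (extF δ⊆δ′ δ′⊆δ Fδ))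

  Extensional-Between : ∀ σ γ → Extensional (Between σ γ)
  Extensional-Between σ γ δ⊆δ′ δ′⊆δ (σ⊆δ , δ⊆γ) = ⊆ₛ-trans σ⊆δ δ⊆δ′ , ⊆ₛ-trans δ′⊆δ δ⊆γ

  Collapsible-mono : ∀ {d d′} {W : Complex n} → d ℕ.≤ d′ → Collapsible d W → Collapsible d′ W
  Collapsible-mono d≤d′ (done void) = done void
  Collapsible-mono d≤d′ (step Y elementary collapsible) = step Y (record
    { σ = σ ; γ = γ ; σ∈X = σ∈X ; card≤d = ℕ.≤-trans card≤d d≤d′ ; σ⊆γ = σ⊆γ
    ; γ-max = γ-max ; unique = unique ; Y-def₁ = Y-def₁ ; Y-def₂ = Y-def₂ })
    (Collapsible-mono d≤d′ collapsible)
    where open ElemCollapse elementary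

  module _ (X : Complex n) where

    ∖-antitone : R ⊑ R′ → ∀ {δ} → (X ∖ R′) δ → (X ∖ R) δ
    ∖-antitone {R} R⊑R′ {δ} (Xδ , R′δ) with R δ in Rδ
    ... | true  = ⊥-elim (≡true⇒≢false (R⊑R′ δ Rδ) R′δ)
    ... | false = Xδ , refl

    ∖-≐⁻ : R′ ≐ R ∪ F → ∀ {δ} → (X ∖ R′) δ → (X ∖ R) δ × ¬ F δ
    ∖-≐⁻ R′≐ {δ} X∖R′δ@(_ , R′δ) =
      ∖-antitone (≐-∪⇒⊑ R′≐) X∖R′δ ,
      λ Fδ → ≡true⇒≢false (proj₂ (R′≐ δ) (inj₂ Fδ)) R′δ

    ∖-≐⁺ : R′ ≐ R ∪ F → ∀ {δ} → (X ∖ R) δ → ¬ F δ → (X ∖ R′) δ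
    ∖-≐⁺ {R′} R′≐ {δ} (Xδ , Rδ) ¬Fδ = Xδ , ≢true⇒≡false removed
      where
      removed : R′ δ ≢ true
      removed R′δ with proj₁ (R′≐ δ) R′δ
      ... | inj₁ Rδ′ = ≡true⇒≢false Rδ′ Rδ
      ... | inj₂ Fδ  = ¬Fδ Fδ

    CollapsibleWithout : ℕ → (VSet n → Bool) → (VSet n → Set) → Set₁
    CollapsibleWithout d R F =
      ∀ R′ → R′ ≐ R ∪ F → Extensional (λ δ → R′ δ ≡ true) → Collapsible d (X ∖ R′)

    CollapsibleWithout-⊎ : ∀ {d} → R₁ ≐ R ∪ F₁ →
      CollapsibleWithout d R (λ δ → F₁ δ ⊎ F₂ δ) → CollapsibleWithout d R₁ F₂
    CollapsibleWithout-⊎ R₁≐ collapse R₂ R₂≐ extR₂ = collapse R₂ (≐-∪-assoc R₁≐ R₂≐) extR₂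

    CollapsibleWithout-[] : ∀ {A : Set} {d} {G : A → VSet n → Set} →
      Extensional (λ δ → R δ ≡ true) → CollapsibleWithout d R (⋃ [] G) → Collapsible d (X ∖ R)
    CollapsibleWithout-[] {R} extR collapse = collapse R ≐-∪-⋃[] extR
      where
      ≐-∪-⋃[] : R ≐ R ∪ ⋃ [] _
      ≐-∪-⋃[] δ = inj₁ , Sum.[ id , (λ ()) ∘ proj₁ ∘ proj₂ ]

    CollapsibleWithout-∷ : ∀ {A : Set} {d} {G : A → VSet n → Set} {a as} → R₁ ≐ R ∪ G a →
      CollapsibleWithout d R (⋃ (a ∷ as) G) → CollapsibleWithout d R₁ (⋃ as G)
    CollapsibleWithout-∷ {G = G} {a} {as} R₁≐ collapse =
      CollapsibleWithout-⊎ R₁≐ λ R′ R′≐ → collapse R′ λ δ →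
        Sum.map₂ split ∘ proj₁ (R′≐ δ) , proj₂ (R′≐ δ) ∘ Sum.map₂ join
      where
      split : ∀ {δ} → G a δ ⊎ ⋃ as G δ → ⋃ (a ∷ as) G δ
      split (inj₁ Gaδ)               = a , here refl , Gaδ
      split (inj₂ (b , b∈as , Gbδ)) = b , there b∈as , Gbδ
      join : ∀ {δ} → ⋃ (a ∷ as) G δ → G a δ ⊎ ⋃ as G δ
      join (b , here refl , Gbδ)  = inj₁ Gbδ
      join (b , there b∈as , Gbδ) = inj₂ (b , b∈as , Gbδ)

    collapse-Between : ∀ {d R} σ γ → Extensional (λ δ → R δ ≡ true) →
      card σ ℕ.≤ d → σ ⊆ₛ γ → (X ∖ R) σ → (X ∖ R) γ →
      (∀ τ → (X ∖ R) τ → σ ⊆ₛ τ → τ ⊆ₛ γ) →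
      CollapsibleWithout d R (Between σ γ) → Collapsible d (X ∖ R)
    collapse-Between {d} {R} σ γ extR ∣σ∣≤d σ⊆γ σ∈ γ∈ cofaces⊆γ collapse =
      step (X ∖ Rσγ) elementary (collapse Rσγ Rσγ≐ (Extensional-≐ extR (Extensional-Between σ γ) Rσγ≐))
      where
      Rσγ : VSet n → Bool
      Rσγ δ = R δ ∨ does (between? σ γ δ)
      Rσγ≐ : Rσγ ≐ R ∪ Between σ γ
      Rσγ≐ = ≐-∪-decidable (between? σ γ)
      elementary : ElemCollapse d (X ∖ R) (X ∖ Rσγ)
      elementary = record
        { σ = σ ; γ = γ ; σ∈X = σ∈ ; card≤d = ∣σ∣≤d ; σ⊆γ = σ⊆γ
        ; γ-max  = γ∈ , λ τ τ∈ γ⊆τ → cofaces⊆γ τ τ∈ (⊆ₛ-trans σ⊆γ γ⊆τ)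
        ; unique = λ τ (τ∈ , τ-max) σ⊆τ →
            let τ⊆γ = cofaces⊆γ τ τ∈ σ⊆τ in τ⊆γ , τ-max γ γ∈ τ⊆γ
        ; Y-def₁ = λ δ → ∖-≐⁻ Rσγ≐
        ; Y-def₂ = λ δ → ∖-≐⁺ Rσγ≐ }

    Collapsible-resp-⇔ : ∀ {d} {W : Complex n} → (∀ δ → W δ → X δ) → (∀ δ → X δ → W δ) →
      Collapsible d X → Collapsible d W
    Collapsible-resp-⇔ W⇒X X⇒W (done void) = done λ τ τ∈W → void τ (W⇒X τ τ∈W)
    Collapsible-resp-⇔ W⇒X X⇒W (step Y elementary collapsible) = step Y (record
      { σ = σ ; γ = γ ; σ∈X = X⇒W σ σ∈X ; card≤d = card≤d ; σ⊆γ = σ⊆γ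
      ; γ-max  = X⇒W γ (proj₁ γ-max) , λ τ τ∈W → proj₂ γ-max τ (W⇒X τ τ∈W)
      ; unique = λ τ (τ∈W , τ-max) → unique τ (W⇒X τ τ∈W , λ τ′ τ′∈X → τ-max τ′ (X⇒W τ′ τ′∈X))
      ; Y-def₁ = λ δ δ∈Y → let δ∈X , outside = Y-def₁ δ δ∈Y in X⇒W δ δ∈X , outside
      ; Y-def₂ = λ δ δ∈W → Y-def₂ δ (W⇒X δ δ∈W) }) collapsible
      where open ElemCollapse elementary

    -- The intervals of Interval k P L are collapsed one by one in lexicographic
    -- order of their bottom sets P ∪ S: when [P ∪ S, P ∪ S ∪ L_{>S}] is reached,
    -- every remaining coface of P ∪ S already lies below its top.
    collapse-Intervals : ∀ {d} k P L R → Unique L → All (λ y → P y ≡ false) L →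
      card P ℕ.+ k ℕ.≤ d → Extensional (λ δ → R δ ≡ true) →
      (∀ τ → (X ∖ R) τ → P ⊆ₛ τ → HasAtLeast k L τ → τ ⊆ₛ (P ∪ₛ fromList L)) →
      (∀ δ → Interval k P L δ → (X ∖ R) δ) →
      CollapsibleWithout d R (Interval k P L) → Collapsible d (X ∖ R)
    collapse-Intervals zero P L R _ _ ∣P∣≤d extR cofaces⊆ present =
      collapse-Between P (P ∪ₛ fromList L) extR (ℕ.≤-trans (ℕ.m≤m+n (card P) 0) ∣P∣≤d)
        (⊆-∪ˡ P (fromList L)) (present P (⊆ₛ-refl , ⊆-∪ˡ P (fromList L)))
        (present (P ∪ₛ fromList L) (⊆-∪ˡ P (fromList L) , ⊆ₛ-refl)) (λ τ τ∈ P⊆τ → cofaces⊆ τ τ∈ P⊆τ tt)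
    collapse-Intervals (suc k) P []      R _ _ _ extR _ _ collapse = collapse R ≐-∪-⊥ extR
    collapse-Intervals (suc k) P (x ∷ L) R (x∉L ∷ uniq) (x∉P ∷ L∩P≡∅) ∣P∣+1+k≤d extR cofaces⊆ present
                       collapse =
      collapse-Intervals k (insert x P) L R uniq L∩xP≡∅ (card-insert-+ x P ∣P∣+1+k≤d) extR
        cofaces-with-x⊆ (λ δ → present δ ∘ inj₁) λ R₁ R₁≐ extR₁ →
      collapse-Intervals (suc k) P L R₁ uniq L∩P≡∅ ∣P∣+1+k≤d extR₁
        (cofaces-without-x⊆ R₁≐) (still-present R₁≐) (CollapsibleWithout-⊎ R₁≐ collapse)
      where
      L∩xP≡∅ : All (λ y → insert x P y ≡ false) L
      L∩xP≡∅ = All.tabulate λ {y} y∈L →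
        ∉-insert {P = P} (λ y≡x → All.lookup x∉L y∈L (sym y≡x)) (All.lookup L∩P≡∅ y∈L)
      cofaces-with-x⊆ : ∀ τ → (X ∖ R) τ → insert x P ⊆ₛ τ → HasAtLeast k L τ →
        τ ⊆ₛ (insert x P ∪ₛ fromList L)
      cofaces-with-x⊆ τ τ∈ xP⊆τ has = ⊆-∪-shiftˡ x P L $
        cofaces⊆ τ τ∈ (⊆ₛ-trans (⊆insert x {P = P}) xP⊆τ) (inj₁ (xP⊆τ x (x∈insert x {P = P}) , has))
      cofaces-without-x⊆ : ∀ {R₁} → R₁ ≐ R ∪ Interval k (insert x P) L →
        ∀ τ → (X ∖ R₁) τ → P ⊆ₛ τ → HasAtLeast (suc k) L τ → τ ⊆ₛ (P ∪ₛ fromList L)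
      cofaces-without-x⊆ R₁≐ τ τ∈ P⊆τ has with ∖-≐⁻ R₁≐ τ∈ | τ x Bool.≟ true
      ... | τ∈X∖R , _          | no  x∉τ =
        ⊆-∪-drop x P L (≢true⇒≡false x∉τ) (cofaces⊆ τ τ∈X∖R P⊆τ (inj₂ has))
      ... | τ∈X∖R , ¬interval  | yes x∈τ = ⊥-elim $ ¬interval $
        Interval⁺ k (insert-⊆ x∈τ P⊆τ) (⊆-∪-shiftˡ x P L (cofaces⊆ τ τ∈X∖R P⊆τ (inj₂ has)))
          (HasAtLeast-pred has)
      still-present : ∀ {R₁} → R₁ ≐ R ∪ Interval k (insert x P) L →
        ∀ δ → Interval (suc k) P L δ → (X ∖ R₁) δ
      still-present R₁≐ δ i = ∖-≐⁺ R₁≐ (present δ (inj₂ i)) x∉-interval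
        where
        x∉-interval : ¬ Interval k (insert x P) L δ
        x∉-interval i′ with ∈-∪⁻ P (fromList L) x $
          proj₁ (proj₂ (Interval⁻ (suc k) i)) x (proj₁ (Interval⁻ k i′) x (x∈insert x {P = P}))
        ... | inj₁ x∈P = ≡true⇒≢false x∈P x∉P
        ... | inj₂ x∈L = All.lookup x∉L (∈fromList⁻ x∈L) refl

    -- Each extension is a maximal face, so it is collapsed alone (σ = γ),
    -- unless an earlier step has already removed it.
    collapse-Extensions : ∀ {d} k P L R → card P ℕ.+ k ℕ.≤ d → Extensional (λ δ → R δ ≡ true) →
      (∀ δ → Extension k P L δ → X δ) →
      (∀ R₀ → R ⊑ R₀ → ∀ δ → Extension k P L δ → ∀ τ → (X ∖ R₀) τ → δ ⊆ₛ τ → τ ⊆ₛ δ) →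
      CollapsibleWithout d R (Extension k P L) → Collapsible d (X ∖ R)
    collapse-Extensions zero P L R ∣P∣≤d extR faces maximal collapse with R P in RP
    ... | true  = collapse R already-removed extR
      where
      already-removed : R ≐ R ∪ Extension zero P L
      already-removed δ = inj₁ , λ { (inj₁ Rδ) → Rδ ; (inj₂ (P⊆δ , δ⊆P)) → extR P⊆δ δ⊆P RP }
    ... | false = collapse-Between P P extR (ℕ.≤-trans (ℕ.m≤m+n (card P) 0) ∣P∣≤d) ⊆ₛ-refl P∈ P∈
                    (maximal R (λ _ Rδ → Rδ) P (⊆ₛ-refl , ⊆ₛ-refl))
                    collapse
      where
      P∈ : (X ∖ R) P
      P∈ = faces P (⊆ₛ-refl , ⊆ₛ-refl) , RP
    collapse-Extensions (suc k) P []      R _ extR _ _ collapse = collapse R ≐-∪-⊥ extR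
    collapse-Extensions (suc k) P (x ∷ L) R ∣P∣+1+k≤d extR faces maximal collapse =
      collapse-Extensions k (insert x P) L R (card-insert-+ x P ∣P∣+1+k≤d) extR
        (λ δ → faces δ ∘ inj₁) (λ R₀ R⊑R₀ δ → maximal R₀ R⊑R₀ δ ∘ inj₁) λ R₁ R₁≐ extR₁ →
      collapse-Extensions (suc k) P L R₁ ∣P∣+1+k≤d extR₁
        (λ δ → faces δ ∘ inj₂) (λ R₀ R₁⊑R₀ δ → maximal R₀ (⊑-trans (≐-∪⇒⊑ R₁≐) R₁⊑R₀) δ ∘ inj₂)
        (CollapsibleWithout-⊎ R₁≐ collapse)

module _ {n : ℕ} where

  private
    variable
      c v w : V n
      δ τ : VSet n
      L L′ : List (V n)

  ⊆N[]⇒⊆closedNbhd : τ ⊆N[ c ] → τ ⊆ₛ fromList (closedNbhd c)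
  ⊆N[]⇒⊆closedNbhd τ⊆N[c] u u∈τ = ∈fromList⁺ (∈N[]⇒∈closedNbhd (τ⊆N[c] u u∈τ))

  ⊆closedNbhd⇒⊆N[] : τ ⊆ₛ fromList (closedNbhd c) → τ ⊆N[ c ]
  ⊆closedNbhd⇒⊆N[] τ⊆ u u∈τ = ∈closedNbhd⇒∈N[] (∈fromList⁻ (τ⊆ u u∈τ))

  Triple-transfer : (∀ u → u ∈ₛ τ → u ∈ L′) → Triple L τ → Triple L′ τ
  Triple-transfer τ⊆L′ (triple x≢y x≢z y≢z _ _ _ x∈τ y∈τ z∈τ) =
    triple x≢y x≢z y≢z (τ⊆L′ _ x∈τ) (τ⊆L′ _ y∈τ) (τ⊆L′ _ z∈τ) x∈τ y∈τ z∈τ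

  Pair-transfer : (∀ u → u ∈ₛ τ → u ∈ L′) → Pair L τ → Pair L′ τ
  Pair-transfer τ⊆L′ (pair x≢y _ _ x∈τ y∈τ) = pair x≢y (τ⊆L′ _ x∈τ) (τ⊆L′ _ y∈τ) x∈τ y∈τ

  -- Large w δ: δ ⊆ N[w] and δ has at least three vertices.
  Large : V n → VSet n → Set
  Large w = Interval 3 ∅ₛ (closedNbhd w)

  Edge : V n → VSet n → Set
  Edge c = Extension 2 ∅ₛ (closedNbhd c)

  Vertex : VSet n → Set
  Vertex = Extension 1 ∅ₛ (allV n)

  Triple⇒centre : Triple (closedNbhd v) τ → τ ⊆N[ w ] → v ≡ w
  Triple⇒centre (triple x≢y x≢z y≢z x∈N y∈N z∈N x∈τ y∈τ z∈τ) τ⊆N[w] =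
    three-common-neighbours⇒≡ x≢y x≢z y≢z
      (∈closedNbhd⇒∈N[] x∈N) (∈closedNbhd⇒∈N[] y∈N) (∈closedNbhd⇒∈N[] z∈N)
      (τ⊆N[w] _ x∈τ) (τ⊆N[w] _ y∈τ) (τ⊆N[w] _ z∈τ)

  Interval-closedNbhd⇒Čech₂ : ∀ k → Interval (suc k) ∅ₛ (closedNbhd c) δ → Čech₂ n δ
  Interval-closedNbhd⇒Čech₂ {c} k i with Interval⁻ (suc k) i
  ... | _ , δ⊆N , has = let a , _ , a∈δ = HasAtLeast-suc⁻ has
                        in ⊆N[]⇒Čech₂ c (a , a∈δ) (⊆closedNbhd⇒⊆N[] δ⊆N)

  Large-centre-unique : Large v δ → Large w δ → v ≡ w
  Large-centre-unique {v} large-v large-w with Interval⁻ 3 large-v | Interval⁻ 3 large-w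
  ... | _ , _ , has | _ , δ⊆N[w] , _ =
    Triple⇒centre (HasAtLeast3⁻ (closedNbhd-unique v) has) (⊆closedNbhd⇒⊆N[] δ⊆N[w])

  HasAtLeast3⇒⊆closedNbhd : Čech₂ n τ → HasAtLeast 3 (closedNbhd v) τ → τ ⊆ₛ fromList (closedNbhd v)
  HasAtLeast3⇒⊆closedNbhd {τ} {v} τ∈ has =
    let c , τ⊆N[c] = Čech₂⇒⊆N[] τ∈
        v≡c        = Triple⇒centre (HasAtLeast3⁻ (closedNbhd-unique v) has) τ⊆N[c]
    in ⊆N[]⇒⊆closedNbhd (subst (τ ⊆N[_]) (sym v≡c) τ⊆N[c])

  Vertex⇒singleton : Vertex δ → ∃ λ x → x ∈ₛ δ × (∀ u → u ∈ₛ δ → u ≡ x)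
  Vertex⇒singleton = go (allV n)
    where
    go : ∀ L {δ} → Extension 1 ∅ₛ L δ → ∃ λ x → x ∈ₛ δ × (∀ u → u ∈ₛ δ → u ≡ x)
    go (x ∷ L) (inj₁ (x⊆δ , δ⊆x)) =
      x , x⊆δ x (x∈insert x {P = ∅ₛ}) , λ u u∈δ → singleton-member u (δ⊆x u u∈δ)
      where
      singleton-member : ∀ u → u ∈ₛ insert x ∅ₛ → u ≡ x
      singleton-member u u∈ with ∈-insert⁻ {P = ∅ₛ} u u∈
      ... | inj₁ u≡x = u≡x
    go (x ∷ L) (inj₂ e) = go L e

  Vertex⇒Čech₂ : Vertex δ → Čech₂ n δ
  Vertex⇒Čech₂ vertex with Vertex⇒singleton vertex
  ... | x , x∈δ , δ≡x = ⊆N[]⇒Čech₂ x (x , x∈δ) (λ u u∈δ → inj₁ (δ≡x u u∈δ))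

  FacesHaveAtMost : ℕ → (VSet n → Bool) → Set
  FacesHaveAtMost k R = ∀ τ → (Čech₂ n ∖ R) τ → ¬ HasAtLeast (suc k) (allV n) τ

  FacesHaveAtMost-antitone : ∀ {k R R′} → R ⊑ R′ → FacesHaveAtMost k R → FacesHaveAtMost k R′
  FacesHaveAtMost-antitone R⊑R′ atMost τ τ∈ = atMost τ (∖-antitone (Čech₂ n) R⊑R′ τ∈)

  ∣∅∣+k≤d : ∀ {k d} → k ℕ.≤ d → card (∅ₛ {n}) ℕ.+ k ℕ.≤ d
  ∣∅∣+k≤d {k} k≤d = subst (ℕ._≤ _) (cong (ℕ._+ k) (sym (card-∅ {n}))) k≤d

  collapse-Large : ∀ Vs R → Unique Vs → Extensional (λ δ → R δ ≡ true) →
    (∀ δ → R δ ≡ true → ∃ λ w → ¬ w ∈ Vs × Large w δ) →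
    CollapsibleWithout (Čech₂ n) 3 R (⋃ Vs Large) → Collapsible 3 (Čech₂ n ∖ R)
  collapse-Large [] R _ extR _ = CollapsibleWithout-[] (Čech₂ n) extR
  collapse-Large (v ∷ Vs) R (v∉Vs ∷ uniq) extR removed⇒other collapse =
    collapse-Intervals (Čech₂ n) 3 ∅ₛ (closedNbhd v) R (closedNbhd-unique v) (All.tabulate (λ _ → refl))
      (∣∅∣+k≤d ℕ.≤-refl) extR (λ τ (τ∈ , _) _ → HasAtLeast3⇒⊆closedNbhd τ∈) present
      λ R₁ R₁≐ extR₁ → collapse-Large Vs R₁ uniq extR₁ (removed⇒other₁ R₁≐)
        (CollapsibleWithout-∷ (Čech₂ n) R₁≐ collapse)
    where
    -- A Large face determines its centre, so the ones around v have not been removed yet.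
    present : ∀ δ → Large v δ → (Čech₂ n ∖ R) δ
    present δ large = Interval-closedNbhd⇒Čech₂ 2 large , ≢true⇒≡false λ Rδ →
      let w , w∉ , large-w = removed⇒other δ Rδ in w∉ (here (Large-centre-unique large-w large))
    removed⇒other₁ : ∀ {R₁} → R₁ ≐ R ∪ Large v → ∀ δ → R₁ δ ≡ true → ∃ λ w → ¬ w ∈ Vs × Large w δ
    removed⇒other₁ R₁≐ δ R₁δ with proj₁ (R₁≐ δ) R₁δ
    ... | inj₁ Rδ    = let w , w∉ , large-w = removed⇒other δ Rδ in w , w∉ ∘ there , large-w
    ... | inj₂ large = v , (λ v∈Vs → All.lookup v∉Vs v∈Vs refl) , large

  collapse-Edges : ∀ Cs R → Extensional (λ δ → R δ ≡ true) → FacesHaveAtMost 2 R →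
    CollapsibleWithout (Čech₂ n) 3 R (⋃ Cs Edge) → Collapsible 3 (Čech₂ n ∖ R)
  collapse-Edges [] R extR _ = CollapsibleWithout-[] (Čech₂ n) extR
  collapse-Edges (c ∷ Cs) R extR atMost2 collapse =
    collapse-Extensions (Čech₂ n) 2 ∅ₛ (closedNbhd c) R (∣∅∣+k≤d (ℕ.n≤1+n 2)) extR
      (λ δ → Interval-closedNbhd⇒Čech₂ 1 ∘ Extension⇒Interval 2) maximal
      λ R₁ R₁≐ extR₁ → collapse-Edges Cs R₁ extR₁ (FacesHaveAtMost-antitone (≐-∪⇒⊑ R₁≐) atMost2)
        (CollapsibleWithout-∷ (Čech₂ n) R₁≐ collapse)
    where
    maximal : ∀ R₀ → R ⊑ R₀ → ∀ δ → Edge c δ → ∀ τ → (Čech₂ n ∖ R₀) τ → δ ⊆ₛ τ → τ ⊆ₛ δ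
    maximal R₀ R⊑R₀ δ edge τ τ∈ δ⊆τ u u∈τ with δ u Bool.≟ true
    ... | yes u∈δ = u∈δ
    ... | no  u∉δ
      with HasAtLeast2⁻ (closedNbhd-unique c) (proj₂ (proj₂ (Interval⁻ 2 (Extension⇒Interval 2 edge))))
    ...   | pair x≢y _ _ x∈δ y∈δ = ⊥-elim $
      FacesHaveAtMost-antitone R⊑R₀ atMost2 τ τ∈ (HasAtLeast3⁺
        (triple x≢y (λ x≡u → u∉δ (subst (_∈ₛ δ) x≡u x∈δ)) (λ y≡u → u∉δ (subst (_∈ₛ δ) y≡u y∈δ))
           (∈allV _) (∈allV _) (∈allV u) (δ⊆τ _ x∈δ) (δ⊆τ _ y∈δ) u∈τ))

  collapse-Vertices : ∀ R → Extensional (λ δ → R δ ≡ true) → FacesHaveAtMost 1 R →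
    CollapsibleWithout (Čech₂ n) 3 R Vertex → Collapsible 3 (Čech₂ n ∖ R)
  collapse-Vertices R extR atMost1 =
    collapse-Extensions (Čech₂ n) 1 ∅ₛ (allV n) R (∣∅∣+k≤d (s≤s z≤n)) extR
      (λ δ → Vertex⇒Čech₂) maximal
    where
    maximal : ∀ R₀ → R ⊑ R₀ → ∀ δ → Vertex δ → ∀ τ → (Čech₂ n ∖ R₀) τ → δ ⊆ₛ τ → τ ⊆ₛ δ
    maximal R₀ R⊑R₀ δ vertex τ τ∈ δ⊆τ u u∈τ with Vertex⇒singleton vertex
    ... | x , x∈δ , _ with u ≟ᵥ x
    ...   | yes refl = x∈δ
    ...   | no  u≢x  = ⊥-elim (FacesHaveAtMost-antitone R⊑R₀ atMost1 τ τ∈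
                                     (HasAtLeast2⁺ (pair u≢x (∈allV u) (∈allV x) u∈τ (δ⊆τ x x∈δ))))

  ∖-not-removed : ∀ {R τ} → (Čech₂ n ∖ R) τ → R τ ≢ true
  ∖-not-removed (_ , Rτ) Rτ′ = ≡true⇒≢false Rτ′ Rτ

  no-triangles : ∀ {R} → (∀ c δ → Large c δ → R δ ≡ true) → FacesHaveAtMost 2 R
  no-triangles {R} removed τ τ∈ has with Čech₂⇒⊆N[] (proj₁ τ∈)
  ... | c , τ⊆N[c] = ∖-not-removed {R} τ∈ $ removed c τ $
    Interval⁺ 3 (λ _ ()) (⊆N[]⇒⊆closedNbhd τ⊆N[c])
      (HasAtLeast3⁺ (Triple-transfer (λ u u∈τ → ∈N[]⇒∈closedNbhd (τ⊆N[c] u u∈τ))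
                                     (HasAtLeast3⁻ (allV-unique n) has)))

  no-edges : ∀ {R} → FacesHaveAtMost 2 R → (∀ c δ → Edge c δ → R δ ≡ true) → FacesHaveAtMost 1 R
  no-edges {R} atMost2 removed τ τ∈ has with Čech₂⇒⊆N[] (proj₁ τ∈)
  ... | c , τ⊆N[c] = ∖-not-removed {R} τ∈ $ removed c τ $
    Extension⁺ 2 (λ _ ()) (⊆N[]⇒⊆closedNbhd τ⊆N[c])
      (HasAtLeast2⁺ (Pair-transfer (λ u u∈τ → ∈N[]⇒∈closedNbhd (τ⊆N[c] u u∈τ))
                                   (HasAtLeast2⁻ (allV-unique n) has)))
      (λ has₃ → atMost2 τ τ∈ (HasAtLeast3⁺ (Triple-transfer (λ u _ → ∈allV u)
                                             (HasAtLeast3⁻ (closedNbhd-unique c) has₃))))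

  no-faces : ∀ {R} → FacesHaveAtMost 1 R → (∀ δ → Vertex δ → R δ ≡ true) → Void (Čech₂ n ∖ R)
  no-faces {R} atMost1 removed τ τ∈@(((a , a∈τ) , _) , _) = ∖-not-removed {R} τ∈ $ removed τ $
    Extension⁺ 1 (λ _ ()) (λ u _ → ∈fromList⁺ (∈allV u)) (HasAtLeast1⁺ (∈allV a) a∈τ) (atMost1 τ τ∈)

  Čech₂-3-collapsible : Collapsible 3 (Čech₂ n)
  Čech₂-3-collapsible =
    Collapsible-resp-⇔ (Čech₂ n ∖ (λ _ → false)) (λ δ δ∈ → δ∈ , refl) (λ δ → proj₁) $
    collapse-Large (allV n) (λ _ → false) (allV-unique n) (λ _ _ ()) (λ _ ()) λ R₁ R₁≐ extR₁ →
    let atMost2 = no-triangles λ c δ large → ≐-∪-removes R₁≐ (c , ∈allV c , large) in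
    collapse-Edges (allV n) R₁ extR₁ atMost2 λ R₂ R₂≐ extR₂ →
    let atMost1 = no-edges (FacesHaveAtMost-antitone (≐-∪⇒⊑ R₂≐) atMost2)
                    λ c δ edge → ≐-∪-removes R₂≐ (c , ∈allV c , edge) in
    collapse-Vertices R₂ extR₂ atMost1 λ R₃ R₃≐ _ →
    done (no-faces (FacesHaveAtMost-antitone (≐-∪⇒⊑ R₃≐) atMost1) λ δ → ≐-∪-removes R₃≐)

module _ {n : ℕ} where

  maximal-above : ∀ (W : Complex n) {τ} → W τ → ¬ ¬ (∃ λ γ → Maximal W γ × τ ⊆ₛ γ)
  maximal-above W {τ} τ∈W = go (length (allV n)) τ∈W (ℕ.m≤n+m _ (card τ))
    where
    go : ∀ k {τ} → W τ → length (allV n) ℕ.≤ card τ ℕ.+ k → ¬ ¬ (∃ λ γ → Maximal W γ × τ ⊆ₛ γ)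
    go k {τ} τ∈W bound no-maximal = no-maximal (τ , (τ∈W , τ-maximal) , ⊆ₛ-refl)
      where
      τ-maximal : ∀ τ′ → W τ′ → τ ⊆ₛ τ′ → τ′ ⊆ₛ τ
      τ-maximal τ′ τ′∈W τ⊆τ′ v v∈τ′ with τ v in τv
      ... | true  = refl
      ... | false = ⊥-elim (larger k bound)
        where
        τ<τ′ : card τ ℕ.< card τ′
        τ<τ′ = card-⊂ v τ⊆τ′ v∈τ′ τv
        larger : ∀ k → length (allV n) ℕ.≤ card τ ℕ.+ k → ⊥
        larger zero bound₀ = ℕ.<-irrefl refl $ ℕ.≤-trans τ<τ′ $ ℕ.≤-trans (card≤∣allV∣ τ′) $
          ℕ.≤-trans bound₀ (ℕ.≤-reflexive (ℕ.+-identityʳ (card τ)))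
        larger (suc k) bound₁ = go k τ′∈W bound′
          λ (γ , γ-max , τ′⊆γ) → no-maximal (γ , γ-max , ⊆ₛ-trans τ⊆τ′ τ′⊆γ)
          where
          bound′ : length (allV n) ℕ.≤ card τ′ ℕ.+ k
          bound′ = ℕ.≤-trans bound₁ (ℕ.≤-trans (ℕ.≤-reflexive (ℕ.+-suc (card τ) k)) (ℕ.+-monoˡ-≤ k τ<τ′))

module _ (m : ℕ) where

  corner : Bool → Bool → V (2 ℕ.+ m)
  corner p q = p ∷ q ∷ replicate m false

  onSquare : V (2 ℕ.+ m) → Bool
  onSquare (_ ∷ _ ∷ w) = does (w ≟ᵥ replicate m false)

  squareWithout : Bool → Bool → VSet (2 ℕ.+ m)
  squareWithout p q u = onSquare u ∧ not (does (u ≟ᵥ corner p q))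

  corner-injective : ∀ {p q p′ q′} → corner p q ≡ corner p′ q′ → p ≡ p′ × q ≡ q′
  corner-injective refl = refl , refl

  ∈squareWithout⁻ : ∀ {p q u} → u ∈ₛ squareWithout p q →
    ∃ λ x → ∃ λ y → u ≡ corner x y × ¬ (x ≡ p × y ≡ q)
  ∈squareWithout⁻ {p} {q} {x ∷ y ∷ w} u∈ with ∧-≡true⁻ (onSquare (x ∷ y ∷ w)) u∈
  ... | on , off with does-true⇒ (w ≟ᵥ replicate m false) on
  ... | refl = x , y , refl , λ { (refl , refl) →
    ≡true⇒≢false off (cong not (dec-true (corner p q ≟ᵥ corner p q) refl)) }

  ∈squareWithout⁺ : ∀ {p q} x y → ¬ (x ≡ p × y ≡ q) → corner x y ∈ₛ squareWithout p q
  ∈squareWithout⁺ {p} {q} x y ≢pq = ∧-≡true⁺ (dec-true (replicate m false ≟ᵥ replicate m false) refl)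
    (cong not (dec-false (corner x y ≟ᵥ corner p q) (≢pq ∘ corner-injective)))

  corner∈N[opposite] : ∀ {p q x y} → ¬ (x ≡ p × y ≡ q) → corner x y ∈N[ corner (not p) (not q) ]
  corner∈N[opposite] {p} {q} {x} {y} ≢pq with x Bool.≟ p | y Bool.≟ q
  ... | yes refl | yes refl = ⊥-elim (≢pq (refl , refl))
  ... | no  x≢p  | no  y≢q  = inj₁ (cong₂ corner (≢⇒≡not x≢p) (≢⇒≡not y≢q))
  ... | yes refl | no  y≢q  = inj₂ (subst (λ u → Adj u (corner (not x) (not q)))
                                         (cong₂ corner (not-involutive x) (sym (≢⇒≡not y≢q)))
                                         (Adj-flip zero (corner (not x) (not q))))
  ... | no  x≢p  | yes refl = inj₂ (subst (λ u → Adj u (corner (not p) (not y)))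
                                         (cong₂ corner (sym (≢⇒≡not x≢p)) (not-involutive y))
                                         (Adj-flip (suc zero) (corner (not p) (not y))))

  squareWithout-face : ∀ p q → Čech₂ (2 ℕ.+ m) (squareWithout p q)
  squareWithout-face p q =
    ⊆N[]⇒Čech₂ (corner (not p) (not q))
      (corner (not p) (not q) , ∈squareWithout⁺ (not p) (not q) (not-¬ refl ∘ sym ∘ proj₁))
      λ u u∈ → let x , y , u≡xy , ≢pq = ∈squareWithout⁻ u∈
               in subst (_∈N[ corner (not p) (not q) ]) (sym u≡xy) (corner∈N[opposite] ≢pq)

  -- The corner opposite to the centre in the first two coordinates is at distance 2 from it.
  face-misses-corner : ∀ {γ} → Čech₂ (2 ℕ.+ m) γ → ∃ λ a → ∃ λ b → γ (corner a b) ≡ false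
  face-misses-corner {γ} γ∈ with Čech₂⇒⊆N[] γ∈
  ... | c₀ ∷ c₁ ∷ _ , γ⊆N[c] = not c₀ , not c₁ , ≢true⇒≡false λ opposite∈γ →
    case ∈N[]-differs-once {i = zero} {j = suc zero} (γ⊆N[c] _ opposite∈γ)
           (not-¬ refl ∘ sym) (not-¬ refl ∘ sym) of λ ()

  ⊆squareWithout-swap : ∀ {δ p q p′ q′} → δ ⊆ₛ squareWithout p q → δ (corner p′ q′) ≡ false →
    δ ⊆ₛ squareWithout p′ q′
  ⊆squareWithout-swap {p = p} {q} {p′} {q′} δ⊆ δ∌ u u∈δ with ∈squareWithout⁻ {p} {q} {u} (δ⊆ u u∈δ)
  ... | x , y , refl , _ = ∈squareWithout⁺ x y λ { (refl , refl) → ≡true⇒≢false u∈δ δ∌ }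

  module _ {W Y : Complex (2 ℕ.+ m)} (elementary : ElemCollapse 2 W Y)
           (W⊆Čech₂ : ∀ δ → W δ → Čech₂ (2 ℕ.+ m) δ) (squares∈W : ∀ p q → W (squareWithout p q)) where

    open ElemCollapse elementary

    σ-misses-another-corner : ∀ a b → ∃ λ p → ∃ λ q → σ (corner p q) ≡ false × ¬ (a ≡ p × b ≡ q)
    σ-misses-another-corner a b with σ (corner (not a) b) Bool.≟ true
                                   | σ (corner a (not b)) Bool.≟ true
                                   | σ (corner (not a) (not b)) Bool.≟ true
    ... | no ∌ | _    | _    = not a , b     , ≢true⇒≡false ∌ , not-¬ refl ∘ proj₁
    ... | _    | no ∌ | _    = a     , not b , ≢true⇒≡false ∌ , not-¬ refl ∘ proj₂
    ... | _    | _    | no ∌ = not a , not b , ≢true⇒≡false ∌ , not-¬ refl ∘ proj₁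
    ... | yes ∋₁ | yes ∋₂ | yes ∋₃ = ⊥-elim $ ℕ.<-irrefl refl $ ℕ.<-≤-trans (card-three
          (not-¬ refl ∘ sym ∘ proj₁ ∘ corner-injective)
          (not-¬ refl ∘ proj₂ ∘ corner-injective)
          (not-¬ refl ∘ proj₁ ∘ corner-injective) ∋₁ ∋₂ ∋₃) card≤d

    squareWithout-survives : ∀ p q → ¬ (σ ⊆ₛ squareWithout p q × squareWithout p q ⊆ₛ γ)
    squareWithout-survives p q (σ⊆ , _) =
      let a , b , γ∌ab          = face-misses-corner (W⊆Čech₂ γ (proj₁ γ-max))
          p′ , q′ , σ∌p′q′ , ab≢ = σ-misses-another-corner a b
      in maximal-above W (squares∈W p′ q′) λ (γ′ , γ′-max , ⊆γ′) →
           let γ′⊆γ = proj₁ (unique γ′ γ′-max (⊆ₛ-trans (⊆squareWithout-swap σ⊆ σ∌p′q′) ⊆γ′))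
           in ≡true⇒≢false (γ′⊆γ _ (⊆γ′ _ (∈squareWithout⁺ a b ab≢))) γ∌ab

  not-2-collapsible : ∀ {W} → Collapsible 2 W → (∀ δ → W δ → Čech₂ (2 ℕ.+ m) δ) →
    (∀ p q → W (squareWithout p q)) → ⊥
  not-2-collapsible (done void) _ squares∈W = void _ (squares∈W true true)
  not-2-collapsible (step Y elementary collapsible) W⊆Čech₂ squares∈W =
    not-2-collapsible collapsible (λ δ δ∈Y → W⊆Čech₂ δ (proj₁ (Y-def₁ δ δ∈Y)))
      λ p q → Y-def₂ _ (squares∈W p q) (squareWithout-survives elementary W⊆Čech₂ squares∈W p q)
    where open ElemCollapse elementary

lemma7p3 : (n : ℕ) → n ≥ 2 → CollapsibilityNumber (Cech n ((+ 2) / 1)) 3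
lemma7p3 (suc (suc m)) (s≤s (s≤s z≤n)) =
  Čech₂-3-collapsible , λ d d<3 d-collapsible →
    not-2-collapsible m (Collapsible-mono (ℕ.≤-pred d<3) d-collapsible) (λ _ δ∈ → δ∈)
      (squareWithout-face m)
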